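{- Let $(a_n)_{n=1}^\infty$ be a sequence of positive integers, and suppose there exist $(c_1,\ldots,c_s)\in\mathbb{Z}^s$ and $(t_1,\ldots,t_s)\in\mathbb{Z}_{\ge0}^s$ such that for all sufficiently large $n$, $(a_n)$ is increasing and $$a_n\ =\ c_1a_{n-1}^{t_1}+c_2a_{n-2}^{t_2}+\cdots+c_sa_{n-s}^{t_s}.$$ Then for every $k\in\mathbb{N}$ the sequence $(\Gamma(k,a_n))_{n=1}^\infty$ is eventually periodic. In particular, if $\pi(m)$ denotes the (eventual) period of the sequence $(a_n \bmod m)_{n=1}^\infty$, then $T_k((a_n)_{n=1}^\infty)$ divides $\pi(2k)$.
   Context: For relatively prime positive integers $a',b'$, exactly one of the two equations $a'x+b'y=\frac{(a'-1)(b'-1)}{2}$ and $1+a'x+b'y=\frac{(a'-1)(b'-1)}{2}$ has a solution $(x,y)$ in nonnegative integers (and it is unique). For $a,b\in\mathbb{N}$ let $g=\gcd(a,b)$, $a'=a/g$, $b'=b/g$; define $\Gamma(a,b)=0$ if $a'x+b'y=\frac{(a'-1)(b'-1)}{2}$ has a nonnegative integral solution, and $\Gamma(a,b)=1$ if $1+a'x+b'y=\frac{(a'-1)(b'-1)}{2}$ has a nonnegative integral solution. For $k\in\mathbb{N}$ and a sequence of positive integers $(a_n)_{n=1}^\infty$, $T_k((a_n)_{n=1}^\infty)$ denotes the eventual (minimal) period of the sequence $(\Gamma(k,a_n))_{n=1}^\infty$, when it exists. -}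

module Defs where

open import Data.Nat using (ℕ; zero; suc; _+_; _*_; _∸_; _≤_; _<_; _%_; _/_; _≡ᵇ_; NonZero)
open import Data.Nat.GCD using (gcd)
open import Data.Nat.Divisibility using (_∣_)
open import Data.Bool using (Bool; true; false; _∨_; if_then_else_)
open import Data.Fin using (Fin; toℕ)
import Data.Fin as F
open import Data.Integer as ℤ using (ℤ)
open import Data.Product using (Σ; ∃; _×_; _,_)
open import Relation.Binary.PropositionalEquality using (_≡_)

-- division by g, with the (irrelevant here) convention x / 0 = 0
quot : ℕ → ℕ → ℕ
quot a zero    = 0
quot a (suc g) = a / suc g

anyUpTo : ℕ → (ℕ → Bool) → Bool
anyUpTo zero    p = p 0
anyUpTo (suc n) p = anyUpTo n p ∨ p (suc n)

-- Does a x + b y = c have a solution (x , y) in nonnegative integers?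
-- For a , b ≥ 1 any solution has x , y ≤ c, so this bounded search is exact.
solvableᵇ : ℕ → ℕ → ℕ → Bool
solvableᵇ a b c = anyUpTo c (λ x → anyUpTo c (λ y → (a * x + b * y) ≡ᵇ c))

-- Γ(a,b): with g = gcd a b, a' = a/g, b' = b/g,
-- Γ = 0 if a' x + b' y = (a'-1)(b'-1)/2 has a nonnegative solution,
-- and Γ = 1 otherwise (i.e. exactly when 1 + a' x + b' y = (a'-1)(b'-1)/2 does).
Γ : ℕ → ℕ → ℕ
Γ a b =
  let g  = gcd a b
      a' = quot a g
      b' = quot b g
  in if solvableᵇ a' b' (((a' ∸ 1) * (b' ∸ 1)) / 2) then 0 else 1

sumFin : (s : ℕ) → (Fin s → ℤ) → ℤ
sumFin zero    f = ℤ.+ 0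
sumFin (suc s) f = f F.zero ℤ.+ sumFin s (λ i → f (F.suc i))

EventualPeriod : {A : Set} → (ℕ → A) → ℕ → Set
EventualPeriod f p = 0 < p × ∃ λ N → ∀ n → N ≤ n → f (n + p) ≡ f n

EventuallyPeriodic : {A : Set} → (ℕ → A) → Set
EventuallyPeriodic f = ∃ λ p → EventualPeriod f p

IsMinimalEventualPeriod : {A : Set} → (ℕ → A) → ℕ → Set
IsMinimalEventualPeriod f p = EventualPeriod f p × (∀ q → EventualPeriod f q → p ≤ q)

-- Hypothesis on (a_n): positive, and for all sufficiently large n increasing and
-- a_n = Σ_{i=1}^{s} c_i a_{n-i}^{t_i}   (Fin index j stands for i = j+1)
EventualPowerRecurrence : (ℕ → ℕ) → Set
EventualPowerRecurrence a =
  Σ ℕ λ s → Σ (Fin s → ℤ) λ c → Σ (Fin s → ℕ) λ t → ∃ λ N → ∀ n → N ≤ n →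
    (a n < a (suc n)) ×
    (ℤ.+ (a n) ≡ sumFin s (λ j → c j ℤ.* ((ℤ.+ (a (n ∸ suc (toℕ j)))) ℤ.^ t j)))

-- x mod m (convention x mod 0 = x; only used with m ≥ 1)
_mod_ : ℕ → ℕ → ℕ
x mod zero    = x
x mod (suc m) = x % suc m

-- Write g = gcd k b, A = k / g and B = b / g. Replacing b by b + 2k keeps g and turns B into
-- B + 2A, while the target ⌊(A-1)(B-1)/2⌋ grows by exactly (A-1)A. The substitution
-- x ↦ x + (A-1) - 2y, y ↦ y maps representations of the old target by (A , B) bijectively onto
-- representations of the new one by (A , B + 2A): in each direction, a substitution that would
-- leave ℕ is ruled out by the size of the target. Hence Γ k is 2k-periodic on positive integers,
-- and Γ k (a n) is a function of a n mod 2k. A recurrence a n = Σ c_i a_{n-i}^{t_i} fixes a n mod m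
-- from the previous s residues, so by the pigeonhole principle on these windows of residues
-- (a n mod m) is eventually periodic. Every eventual period of it is one of Γ k (a n), and a
-- minimal eventual period divides every eventual period.
module Submission where

open import Defs
open import Data.Nat using (ℕ; zero; suc; _+_; _*_; _∸_; _^_; _≤_; _<_; _%_; _/_;
  z≤n; s≤s; s≤s⁻¹; z<s; NonZero; >-nonZero; >-nonZero⁻¹; _≤?_)
open import Data.Nat.Properties
open import Data.Nat.DivMod using (m≡m%n+[m/n]*n; m%n<n; m/n*n≤m; +-distrib-/-∣ʳ; m*n/n≡m;
  *-/-assoc; m≥n⇒m/n>0; %-remove-+ʳ)
open import Data.Nat.Divisibility using (_∣_; m%n≡0⇒n∣m; divides-refl; ∣-antisym; ∣m∣n⇒∣m+n;
  ∣m+n∣m⇒∣n; ∣n⇒∣m*n; ∣⇒≤; 0∣⇒≡0)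
open import Data.Nat.GCD using (gcd; gcd[m,n]∣m; gcd[m,n]∣n; gcd-greatest)
open import Data.Nat.Tactic.RingSolver using (solve-∀)
open import Data.Integer as ℤ using (ℤ)
open import Data.Integer.Properties as ℤ using (pos-+)
open import Data.Integer.DivMod using (a≡a%ℕn+[a/ℕn]*n)
open import Data.Integer.Divisibility.Signed as ℤ using (divides; ∣⇒∣ᵤ)
import Data.Integer.Tactic.RingSolver as ℤ-Solver
open import Data.Bool using (Bool; true; false; if_then_else_; T)
open import Data.Bool.Properties using (T-∨)
open import Data.Fin as Fin using (Fin; toℕ; fromℕ<; inject₁; finToFun; funToFin)
open import Data.Fin.Properties using (pigeonhole; toℕ-fromℕ<; fromℕ<-cong; toℕ-inject₁;
  finToFun-funToFin)
open import Data.Product using (∃; ∃₂; _×_; _,_; proj₁; proj₂)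
open import Data.Sum using (inj₁; inj₂)
open import Data.Empty using (⊥-elim)
open import Function.Base using (_∘_)
open import Function.Bundles using (_⇔_; mk⇔; Equivalence)
import Function.Properties.Equivalence as ⇔
open import Relation.Nullary using (yes; no; contradiction)
open import Relation.Binary.PropositionalEquality

T-anyUpTo : ∀ n (p : ℕ → Bool) → T (anyUpTo n p) ⇔ (∃ λ i → i ≤ n × T (p i))
T-anyUpTo n p = mk⇔ (to n) (λ (i , i≤n , pi) → from n i≤n pi)
  where
  to : ∀ n → T (anyUpTo n p) → ∃ λ i → i ≤ n × T (p i)
  to zero    h = 0 , z≤n , h
  to (suc n) h with Equivalence.to T-∨ h
  ... | inj₁ h′ = let i , i≤n , pi = to n h′ in i , m≤n⇒m≤1+n i≤n , pi
  ... | inj₂ h′ = suc n , ≤-refl , h′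
  from : ∀ n {i} → i ≤ n → T (p i) → T (anyUpTo n p)
  from zero    z≤n  pi = pi
  from (suc n) i≤1+n pi with m≤n⇒m<n∨m≡n i≤1+n
  ... | inj₁ i<1+n = Equivalence.from T-∨ (inj₁ (from n (s≤s⁻¹ i<1+n) pi))
  ... | inj₂ refl  = Equivalence.from T-∨ (inj₂ pi)

T-⇔⇒≡ : ∀ {x y} → T x ⇔ T y → x ≡ y
T-⇔⇒≡ {false} {false} _   = refl
T-⇔⇒≡ {false} {true}  x⇔y = ⊥-elim (Equivalence.from x⇔y _)
T-⇔⇒≡ {true}  {false} x⇔y = ⊥-elim (Equivalence.to x⇔y _)
T-⇔⇒≡ {true}  {true}  _   = refl

Representable : ℕ → ℕ → ℕ → Set
Representable a b c = ∃₂ λ x y → a * x + b * y ≡ c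

T-solvableᵇ : ∀ a b c .{{_ : NonZero a}} .{{_ : NonZero b}} →
              T (solvableᵇ a b c) ⇔ Representable a b c
T-solvableᵇ a b c = mk⇔ sound complete
  where
  sound : T (solvableᵇ a b c) → Representable a b c
  sound h with Equivalence.to (T-anyUpTo c _) h
  ... | x , _ , h′ with Equivalence.to (T-anyUpTo c _) h′
  ... | y , _ , h″ = x , y , ≡ᵇ⇒≡ _ _ h″
  complete : Representable a b c → T (solvableᵇ a b c)
  complete (x , y , eq) =
    Equivalence.from (T-anyUpTo c _) (x , x≤c ,
      Equivalence.from (T-anyUpTo c _) (y , y≤c , ≡⇒≡ᵇ _ _ eq))
    where
    x≤c : x ≤ c
    x≤c = ≤-trans (m≤n*m x a) (≤-trans (m≤m+n (a * x) (b * y)) (≤-reflexive eq))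
    y≤c : y ≤ c
    y≤c = ≤-trans (m≤n*m y b) (≤-trans (m≤n+m (b * y) (a * x)) (≤-reflexive eq))

2*[n/2]≤n : ∀ n → 2 * (n / 2) ≤ n
2*[n/2]≤n n = subst (_≤ n) (*-comm (n / 2) 2) (m/n*n≤m n 2)

n≤1+2*[n/2] : ∀ n → n ≤ suc (2 * (n / 2))
n≤1+2*[n/2] n = begin
  n                  ≡⟨ m≡m%n+[m/n]*n n 2 ⟩
  n % 2 + n / 2 * 2  ≤⟨ +-monoˡ-≤ (n / 2 * 2) (s≤s⁻¹ (m%n<n n 2)) ⟩
  suc (n / 2 * 2)    ≡⟨ cong suc (*-comm (n / 2) 2) ⟩
  suc (2 * (n / 2))  ∎
  where open ≤-Reasoning

-- With A = 1 + a and B = 1 + β, the bounds on N say N = ⌊aβ/2⌋ = ⌊(A-1)(B-1)/2⌋.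
module _ (a β : ℕ) where

  private
    A B : ℕ
    A = suc a
    B = suc β

  representable-shift⁺ : ∀ N → 2 * N ≤ a * β →
    Representable A B N → Representable A (B + 2 * A) (N + a * A)
  representable-shift⁺ N 2N≤aβ (x , y , eq) with 2 * y ≤? x + a
  ... | yes 2y≤x+a = x + a ∸ 2 * y , y , (begin
    A * (x + a ∸ 2 * y) + (B + 2 * A) * y   ≡⟨ regroup A B (x + a ∸ 2 * y) y ⟩
    A * (2 * y + (x + a ∸ 2 * y)) + B * y   ≡⟨ cong (λ z → A * z + B * y) (m+[n∸m]≡n 2y≤x+a) ⟩
    A * (x + a) + B * y                     ≡⟨ expand A B x y a ⟩
    (A * x + B * y) + a * A                 ≡⟨ cong (_+ a * A) eq ⟩
    N + a * A                               ∎)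
    where
    open ≡-Reasoning
    regroup : ∀ A B w y → A * w + (B + 2 * A) * y ≡ A * (2 * y + w) + B * y
    regroup = solve-∀
    expand : ∀ A B x y a → A * (x + a) + B * y ≡ (A * x + B * y) + a * A
    expand = solve-∀
  ... | no 2y≰x+a = contradiction 2N<2N (<-irrefl refl)
    where
    open ≤-Reasoning
    A≤2y : A ≤ 2 * y
    A≤2y = ≤-trans (s≤s (m≤n+m a x)) (≰⇒> 2y≰x+a)
    2N<2N : 2 * N < 2 * N
    2N<2N = begin-strict
      2 * N           ≤⟨ 2N≤aβ ⟩
      a * β           <⟨ *-mono-< (n<1+n a) (n<1+n β) ⟩
      A * B           ≤⟨ *-monoˡ-≤ B A≤2y ⟩
      2 * y * B       ≡⟨ trans (*-assoc 2 y B) (cong (2 *_) (*-comm y B)) ⟩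
      2 * (B * y)     ≤⟨ *-monoʳ-≤ 2 (m≤n+m (B * y) (A * x)) ⟩
      2 * (A * x + B * y) ≡⟨ cong (2 *_) eq ⟩
      2 * N           ∎

  representable-shift⁻ : ∀ N → a * β ≤ suc (2 * N) →
    Representable A (B + 2 * A) (N + a * A) → Representable A B N
  representable-shift⁻ N aβ≤1+2N (u , v , eq) with a ≤? u + 2 * v
  ... | yes a≤u+2v = u + 2 * v ∸ a , v , +-cancelˡ-≡ (a * A) _ _ (begin
    a * A + (A * (u + 2 * v ∸ a) + B * v)   ≡⟨ absorb A B a (u + 2 * v ∸ a) v ⟩
    A * (a + (u + 2 * v ∸ a)) + B * v       ≡⟨ cong (λ z → A * z + B * v) (m+[n∸m]≡n a≤u+2v) ⟩
    A * (u + 2 * v) + B * v                 ≡⟨ regroup A B u v ⟩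
    A * u + (B + 2 * A) * v                 ≡⟨ eq ⟩
    N + a * A                               ≡⟨ +-comm N (a * A) ⟩
    a * A + N                               ∎)
    where
    open ≡-Reasoning
    absorb : ∀ A B a w v → a * A + (A * w + B * v) ≡ A * (a + w) + B * v
    absorb = solve-∀
    regroup : ∀ A B u v → A * (u + 2 * v) + B * v ≡ A * u + (B + 2 * A) * v
    regroup = solve-∀
  ... | no a≰u+2v = contradiction (+-cancelˡ-≤ (2 * (N + a * A)) C A bound) (<⇒≱ A<C)
    where
    open ≤-Reasoning
    C : ℕ
    C = 2 * A + B
    A<C : A < C
    A<C = <-≤-trans (m<m+n A z<s) (m≤m+n (2 * A) B)
    bound : 2 * (N + a * A) + C ≤ 2 * (N + a * A) + A
    bound = begin
      2 * (N + a * A) + C                     ≡⟨ cong (λ z → 2 * z + C) (sym eq) ⟩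
      2 * (A * u + (B + 2 * A) * v) + C       ≤⟨ +-monoˡ-≤ C (m≤m+n _ (B * u)) ⟩
      2 * (A * u + (B + 2 * A) * v) + B * u + C ≡⟨ cong (_+ C) (spread A B u v) ⟩
      C * (u + 2 * v) + C                     ≡⟨ trans (+-comm _ C) (sym (*-suc C (u + 2 * v))) ⟩
      C * suc (u + 2 * v)                     ≤⟨ *-monoʳ-≤ C (≰⇒> a≰u+2v) ⟩
      C * a                                   ≡⟨ expand a β ⟩
      2 * (a * A) + (a * β + a)               ≤⟨ +-monoʳ-≤ (2 * (a * A)) (+-monoˡ-≤ a aβ≤1+2N) ⟩
      2 * (a * A) + (suc (2 * N) + a)         ≡⟨ collect a N ⟩
      2 * (N + a * A) + A                     ∎
      where
      spread : ∀ A B u v → 2 * (A * u + (B + 2 * A) * v) + B * u ≡ (2 * A + B) * (u + 2 * v)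
      spread = solve-∀
      expand : ∀ a β → (2 * suc a + suc β) * a ≡ 2 * (a * suc a) + (a * β + a)
      expand = solve-∀
      collect : ∀ a N → 2 * (a * suc a) + (suc (2 * N) + a) ≡ 2 * (N + a * suc a) + suc a
      collect = solve-∀

Γ′ : ℕ → ℕ → ℕ
Γ′ a′ b′ = if solvableᵇ a′ b′ (((a′ ∸ 1) * (b′ ∸ 1)) / 2) then 0 else 1

Γ′-shift : ∀ A B .{{_ : NonZero A}} .{{_ : NonZero B}} → Γ′ A (B + 2 * A) ≡ Γ′ A B
Γ′-shift (suc a) (suc β) = cong (λ t → if t then 0 else 1) (begin
  solvableᵇ A (B + 2 * A) (a * (β + 2 * A) / 2)  ≡⟨ cong (solvableᵇ A (B + 2 * A)) halve ⟩
  solvableᵇ A (B + 2 * A) (N + a * A)            ≡⟨ T-⇔⇒≡ same-truth ⟩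
  solvableᵇ A B N                                ∎)
  where
  open ≡-Reasoning
  A B N : ℕ
  A = suc a
  B = suc β
  N = a * β / 2
  shift : Representable A B N ⇔ Representable A (B + 2 * A) (N + a * A)
  shift = mk⇔ (representable-shift⁺ a β N (2*[n/2]≤n (a * β)))
              (representable-shift⁻ a β N (n≤1+2*[n/2] (a * β)))
  same-truth : T (solvableᵇ A (B + 2 * A) (N + a * A)) ⇔ T (solvableᵇ A B N)
  same-truth = ⇔.trans (T-solvableᵇ A (B + 2 * A) (N + a * A))
                       (⇔.trans (⇔.sym shift) (⇔.sym (T-solvableᵇ A B N)))
  halve : a * (β + 2 * A) / 2 ≡ N + a * A
  halve = begin
    a * (β + 2 * A) / 2          ≡⟨ cong (_/ 2) (distribute a β) ⟩
    (a * β + a * A * 2) / 2      ≡⟨ +-distrib-/-∣ʳ (a * β) (divides-refl (a * A)) ⟩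
    N + a * A * 2 / 2            ≡⟨ cong (N +_) (m*n/n≡m (a * A) 2) ⟩
    N + a * A                    ∎
    where
    distribute : ∀ a β → a * (β + 2 * suc a) ≡ a * β + a * suc a * 2
    distribute = solve-∀

gcd[m,n+k*m]≡gcd[m,n] : ∀ m n k → gcd m (n + k * m) ≡ gcd m n
gcd[m,n+k*m]≡gcd[m,n] m n k = ∣-antisym
  (gcd-greatest d∣m (∣m+n∣m⇒∣n (subst (gcd m (n + k * m) ∣_) (+-comm n (k * m)) d∣n+km)
                                (∣n⇒∣m*n k d∣m)))
  (gcd-greatest (gcd[m,n]∣m m n) (∣m∣n⇒∣m+n (gcd[m,n]∣n m n) (∣n⇒∣m*n k (gcd[m,n]∣m m n))))
  where
  d∣m : gcd m (n + k * m) ∣ m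
  d∣m = gcd[m,n]∣m m (n + k * m)
  d∣n+km : gcd m (n + k * m) ∣ n + k * m
  d∣n+km = gcd[m,n]∣n m (n + k * m)

quot-distrib-+ : ∀ {g} m n → g ∣ n → quot (m + n) g ≡ quot m g + quot n g
quot-distrib-+ {zero}  m n _   = refl
quot-distrib-+ {suc g} m n g∣n = +-distrib-/-∣ʳ m g∣n

quot-*-assoc : ∀ {g} k n → g ∣ n → quot (k * n) g ≡ k * quot n g
quot-*-assoc {zero}  k n _   = sym (*-zeroʳ k)
quot-*-assoc {suc g} k n g∣n = *-/-assoc k g∣n

quot-pos : ∀ {g n} .{{_ : NonZero n}} → g ∣ n → 0 < quot n g
quot-pos {zero}  {suc n} 0∣n = contradiction (0∣⇒≡0 0∣n) λ ()
quot-pos {suc g}         g∣n = m≥n⇒m/n>0 (∣⇒≤ g∣n)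

Γ-shift : ∀ k b .{{_ : NonZero k}} .{{_ : NonZero b}} → Γ k (b + 2 * k) ≡ Γ k b
Γ-shift k b = begin
  Γ k (b + 2 * k)                          ≡⟨ cong (λ h → Γ′ (quot k h) (quot (b + 2 * k) h))
                                                   (gcd[m,n+k*m]≡gcd[m,n] k b 2) ⟩
  Γ′ (quot k g) (quot (b + 2 * k) g)       ≡⟨ cong (Γ′ (quot k g)) quot-b+2k ⟩
  Γ′ (quot k g) (quot b g + 2 * quot k g)  ≡⟨ Γ′-shift (quot k g) (quot b g)
                                                 {{>-nonZero (quot-pos g∣k)}} {{>-nonZero (quot-pos g∣b)}} ⟩
  Γ k b                                    ∎
  where
  open ≡-Reasoning
  g : ℕ
  g = gcd k b
  g∣k : g ∣ k
  g∣k = gcd[m,n]∣m k b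
  g∣b : g ∣ b
  g∣b = gcd[m,n]∣n k b
  quot-b+2k : quot (b + 2 * k) g ≡ quot b g + 2 * quot k g
  quot-b+2k = trans (quot-distrib-+ b (2 * k) (∣n⇒∣m*n 2 g∣k))
                    (cong (quot b g +_) (quot-*-assoc 2 k g∣k))

module _ {A : Set} {f : ℕ → A} where

  iterate-period : ∀ {p N} → (∀ n → N ≤ n → f (n + p) ≡ f n) →
                   ∀ q n → N ≤ n → f (n + q * p) ≡ f n
  iterate-period         per zero    n N≤n = cong f (+-identityʳ n)
  iterate-period {p} {N} per (suc q) n N≤n = begin
    f (n + (p + q * p))  ≡⟨ cong f (trans (cong (n +_) (+-comm p (q * p))) (sym (+-assoc n (q * p) p))) ⟩
    f (n + q * p + p)    ≡⟨ per (n + q * p) (≤-trans N≤n (m≤m+n n (q * p))) ⟩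
    f (n + q * p)        ≡⟨ iterate-period per q n N≤n ⟩
    f n                  ∎
    where open ≡-Reasoning

  f[n]≡f[n%p+p] : ∀ p .{{_ : NonZero p}} → (∀ n → 1 ≤ n → f (n + p) ≡ f n) →
                  ∀ n → 1 ≤ n → f n ≡ f (n % p + p)
  f[n]≡f[n%p+p] p per n 1≤n =
    trans (cong f (m≡m%n+[m/n]*n n p)) (reduce (n % p) (n / p) (subst (1 ≤_) (m≡m%n+[m/n]*n n p) 1≤n))
    where
    reduce : ∀ r q → 1 ≤ r + q * p → f (r + q * p) ≡ f (r + p)
    reduce r zero    1≤r+0 = trans (cong f (+-identityʳ r))
                                   (sym (per r (subst (1 ≤_) (+-identityʳ r) 1≤r+0)))
    reduce r (suc q) _     = trans (cong f (sym (+-assoc r p (q * p))))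
                                   (iterate-period per q (r + p) (≤-trans (>-nonZero⁻¹ p) (m≤n+m p r)))

  EventualPeriod-∘ : ∀ {B : Set} {g : ℕ → B} (h : B → A) {M p} →
                     (∀ n → M ≤ n → f n ≡ h (g n)) → EventualPeriod g p → EventualPeriod f p
  EventualPeriod-∘ {g = g} h {M} {p} f≡h∘g (p>0 , N , per) = p>0 , M + N , λ n M+N≤n →
    let M≤n = ≤-trans (m≤m+n M N) M+N≤n in
    begin
      f (n + p)      ≡⟨ f≡h∘g (n + p) (≤-trans M≤n (m≤m+n n p)) ⟩
      h (g (n + p))  ≡⟨ cong h (per n (≤-trans (m≤n+m N M) M+N≤n)) ⟩
      h (g n)        ≡⟨ sym (f≡h∘g n M≤n) ⟩
      f n            ∎
    where open ≡-Reasoning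

  minimal-period-∣ : ∀ {T P} → IsMinimalEventualPeriod f T → EventualPeriod f P → T ∣ P
  minimal-period-∣ {T@(suc _)} {P} ((_ , NT , perT) , minimal) (_ , NP , perP) with P % T in P%T≡r
  ... | zero  = m%n≡0⇒n∣m P T P%T≡r
  ... | suc r = contradiction (minimal (suc r) (z<s , NT + NP , perR))
                              (<⇒≱ (subst (_< T) P%T≡r (m%n<n P T)))
    where
    P≡r+qT : P ≡ suc r + P / T * T
    P≡r+qT = trans (m≡m%n+[m/n]*n P T) (cong (_+ P / T * T) P%T≡r)
    perR : ∀ n → NT + NP ≤ n → f (n + suc r) ≡ f n
    perR n NT+NP≤n = begin
      f (n + suc r)                ≡⟨ iterate-period perT (P / T) (n + suc r) NT≤n+r ⟨
      f (n + suc r + P / T * T)    ≡⟨ cong f (trans (+-assoc n (suc r) _) (cong (n +_) (sym P≡r+qT))) ⟩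
      f (n + P)                    ≡⟨ perP n (≤-trans (m≤n+m NP NT) NT+NP≤n) ⟩
      f n                          ∎
      where
      open ≡-Reasoning
      NT≤n+r : NT ≤ n + suc r
      NT≤n+r = ≤-trans (m≤m+n NT NP) (≤-trans NT+NP≤n (m≤m+n n (suc r)))

-- f (n ∸ 1) , … , f (n ∸ s); for n < s the truncated subtraction repeats f 0.
window : ∀ {A : Set} s → (ℕ → A) → ℕ → Fin s → A
window s f n j = f (n ∸ suc (toℕ j))

window-suc : ∀ {A : Set} {s} {f : ℕ → A} {n n′} →
  window s f n ≗ window s f n′ → f n ≡ f n′ → window s f (suc n) ≗ window s f (suc n′)
window-suc         w fn≡fn′ Fin.zero    = fn≡fn′
window-suc {f = f} {n} {n′} w fn≡fn′ (Fin.suc j) =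
  subst (λ i → f (n ∸ suc i) ≡ f (n′ ∸ suc i)) (toℕ-inject₁ j) (w (inject₁ j))

module _ {m s : ℕ} (f : ℕ → Fin m) (N : ℕ)
  (determined : ∀ {n n′} → N ≤ n → N ≤ n′ → window s f n ≗ window s f n′ → f n ≡ f n′) where

  windows-agree-after : ∀ {n n′} → N ≤ n → N ≤ n′ → window s f n ≗ window s f n′ →
                        ∀ u → window s f (u + n) ≗ window s f (u + n′)
  windows-agree-after N≤n N≤n′ w zero    = w
  windows-agree-after {n} {n′} N≤n N≤n′ w (suc u) =
    window-suc {f = f} agree (determined (≤-trans N≤n (m≤n+m n u)) (≤-trans N≤n′ (m≤n+m n′ u)) agree)
    where
    agree : window s f (u + n) ≗ window s f (u + n′)
    agree = windows-agree-after N≤n N≤n′ w u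

  window-determined⇒eventuallyPeriodic : EventuallyPeriodic f
  window-determined⇒eventuallyPeriodic
    with i , j , i<j , code-i≡code-j ← pigeonhole (n<1+n (m ^ s)) (λ i → funToFin (window s f (N + toℕ i)))
    with d , i+1+d≡j ← m≤n⇒∃[o]m+o≡n i<j
    = suc d , s≤s z≤n , N + toℕ i , periodic
    where
    same-window : window s f (N + toℕ i) ≗ window s f (N + toℕ j)
    same-window k = begin
      window s f (N + toℕ i) k                         ≡⟨ finToFun-funToFin (window s f (N + toℕ i)) k ⟨
      finToFun (funToFin (window s f (N + toℕ i))) k   ≡⟨ cong (λ c → finToFun c k) code-i≡code-j ⟩
      finToFun (funToFin (window s f (N + toℕ j))) k   ≡⟨ finToFun-funToFin (window s f (N + toℕ j)) k ⟩
      window s f (N + toℕ j) k                         ∎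
      where open ≡-Reasoning
    periodic : ∀ n → N + toℕ i ≤ n → f (n + suc d) ≡ f n
    periodic n n₀≤n = begin
      f (n + suc d)                ≡⟨ cong f (trans (cong (_+ suc d) (sym u+n₀≡n)) (shift u N (toℕ i) d)) ⟩
      f (u + (N + (suc (toℕ i) + d))) ≡⟨ cong (λ k → f (u + (N + k))) i+1+d≡j ⟩
      f (u + (N + toℕ j))          ≡⟨ determined N≤u+nⱼ N≤u+n₀ (λ k → sym (agree k)) ⟩
      f (u + (N + toℕ i))          ≡⟨ cong f u+n₀≡n ⟩
      f n                          ∎
      where
      open ≡-Reasoning
      u : ℕ
      u = n ∸ (N + toℕ i)
      u+n₀≡n : u + (N + toℕ i) ≡ n
      u+n₀≡n = m∸n+n≡m n₀≤n
      shift : ∀ u N i d → u + (N + i) + suc d ≡ u + (N + (suc i + d))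
      shift = solve-∀
      agree : window s f (u + (N + toℕ i)) ≗ window s f (u + (N + toℕ j))
      agree = windows-agree-after (m≤m+n N (toℕ i)) (m≤m+n N (toℕ j)) same-window u
      N≤u+n₀ : N ≤ u + (N + toℕ i)
      N≤u+n₀ = ≤-trans (m≤m+n N (toℕ i)) (m≤n+m _ u)
      N≤u+nⱼ : N ≤ u + (N + toℕ j)
      N≤u+nⱼ = ≤-trans (m≤m+n N (toℕ j)) (m≤n+m _ u)

-- A record rather than a synonym for ℤ.+ m ℤ.∣ x ℤ.- y, so that x and y can be inferred.
infix 4 _≡[mod_]_
record _≡[mod_]_ (x : ℤ) (m : ℕ) (y : ℤ) : Set where
  constructor congruent
  field m∣x-y : ℤ.+ m ℤ.∣ x ℤ.- y

module _ {m : ℕ} where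

  ≡-mod-refl : ∀ x → x ≡[mod m ] x
  ≡-mod-refl x = congruent (divides (ℤ.+ 0) (ℤ.+-inverseʳ x))

  ≡-mod-sym : ∀ {x y} → x ≡[mod m ] y → y ≡[mod m ] x
  ≡-mod-sym {x} {y} (congruent m∣x-y) =
    congruent (subst (ℤ.+ m ℤ.∣_) (negate x y) (ℤ.∣m⇒∣-m m∣x-y))
    where
    negate : ∀ x y → ℤ.- (x ℤ.- y) ≡ y ℤ.- x
    negate = ℤ-Solver.solve-∀

  +-cong-mod : ∀ {x y u v} → x ≡[mod m ] y → u ≡[mod m ] v → x ℤ.+ u ≡[mod m ] y ℤ.+ v
  +-cong-mod {x} {y} {u} {v} (congruent p) (congruent q) =
    congruent (subst (ℤ.+ m ℤ.∣_) (regroup x y u v) (ℤ.∣m∣n⇒∣m+n p q))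
    where
    regroup : ∀ x y u v → (x ℤ.- y) ℤ.+ (u ℤ.- v) ≡ (x ℤ.+ u) ℤ.- (y ℤ.+ v)
    regroup = ℤ-Solver.solve-∀

  *-cong-mod : ∀ {x y u v} → x ≡[mod m ] y → u ≡[mod m ] v → x ℤ.* u ≡[mod m ] y ℤ.* v
  *-cong-mod {x} {y} {u} {v} (congruent p) (congruent q) =
    congruent (subst (ℤ.+ m ℤ.∣_) (regroup x y u v) (ℤ.∣m∣n⇒∣m+n (ℤ.∣m⇒∣m*n u p) (ℤ.∣n⇒∣m*n y q)))
    where
    regroup : ∀ x y u v → (x ℤ.- y) ℤ.* u ℤ.+ y ℤ.* (u ℤ.- v) ≡ x ℤ.* u ℤ.- y ℤ.* v
    regroup = ℤ-Solver.solve-∀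

  ^-cong-mod : ∀ {x y} t → x ≡[mod m ] y → x ℤ.^ t ≡[mod m ] y ℤ.^ t
  ^-cong-mod zero    _ = ≡-mod-refl (ℤ.+ 1)
  ^-cong-mod (suc t) p = *-cong-mod p (^-cong-mod t p)

  sumFin-cong-mod : ∀ s {f g : Fin s → ℤ} → (∀ j → f j ≡[mod m ] g j) →
                    sumFin s f ≡[mod m ] sumFin s g
  sumFin-cong-mod zero    _ = ≡-mod-refl (ℤ.+ 0)
  sumFin-cong-mod (suc s) p = +-cong-mod (p Fin.zero) (sumFin-cong-mod s (λ j → p (Fin.suc j)))

module _ {m : ℕ} .{{_ : NonZero m}} where

  %-≡⇒≡-mod : ∀ {a b} → a % m ≡ b % m → ℤ.+ a ≡[mod m ] ℤ.+ b
  %-≡⇒≡-mod {a} {b} a%m≡b%m = congruent (divides (qa ℤ.- qb) (begin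
    ℤ.+ a ℤ.- ℤ.+ b                            ≡⟨ cong₂ ℤ._-_ (a≡a%ℕn+[a/ℕn]*n (ℤ.+ a) m)
                                                              (a≡a%ℕn+[a/ℕn]*n (ℤ.+ b) m) ⟩
    (r ℤ.+ qa ℤ.* m′) ℤ.- (ℤ.+ (b % m) ℤ.+ qb ℤ.* m′)
                                               ≡⟨ cong (λ x → (r ℤ.+ qa ℤ.* m′) ℤ.- (ℤ.+ x ℤ.+ qb ℤ.* m′)) a%m≡b%m ⟨
    (r ℤ.+ qa ℤ.* m′) ℤ.- (r ℤ.+ qb ℤ.* m′)    ≡⟨ cancel r qa qb m′ ⟩
    (qa ℤ.- qb) ℤ.* m′                         ∎))
    where
    open ≡-Reasoning
    r qa qb m′ : ℤ
    r = ℤ.+ (a % m)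
    qa = ℤ.+ (a / m)
    qb = ℤ.+ (b / m)
    m′ = ℤ.+ m
    cancel : ∀ r x y m → (r ℤ.+ x ℤ.* m) ℤ.- (r ℤ.+ y ℤ.* m) ≡ (x ℤ.- y) ℤ.* m
    cancel = ℤ-Solver.solve-∀

  private
    ≡-mod⇒%-≡-≥ : ∀ {a b} → b ≤ a → ℤ.+ a ≡[mod m ] ℤ.+ b → a % m ≡ b % m
    ≡-mod⇒%-≡-≥ {b = b} b≤a (congruent m∣a-b) with d , refl ← m≤n⇒∃[o]m+o≡n b≤a =
      %-remove-+ʳ b (∣⇒∣ᵤ (subst (ℤ.+ m ℤ.∣_) a-b≡d m∣a-b))
      where
      cancel : ∀ b d → (b ℤ.+ d) ℤ.- b ≡ d
      cancel = ℤ-Solver.solve-∀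
      a-b≡d : ℤ.+ (b + d) ℤ.- ℤ.+ b ≡ ℤ.+ d
      a-b≡d = trans (cong (ℤ._- ℤ.+ b) (pos-+ b d)) (cancel (ℤ.+ b) (ℤ.+ d))

  ≡-mod⇒%-≡ : ∀ {a b} → ℤ.+ a ≡[mod m ] ℤ.+ b → a % m ≡ b % m
  ≡-mod⇒%-≡ {a} {b} a≡b with ≤-total b a
  ... | inj₁ b≤a = ≡-mod⇒%-≡-≥ b≤a a≡b
  ... | inj₂ a≤b = sym (≡-mod⇒%-≡-≥ a≤b (≡-mod-sym a≡b))

powerSum : ∀ s → (Fin s → ℤ) → (Fin s → ℕ) → (Fin s → ℕ) → ℤ
powerSum s c t u = sumFin s (λ j → c j ℤ.* ((ℤ.+ (u j)) ℤ.^ t j))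

powerSum-cong-mod : ∀ {m} s c t {u v : Fin s → ℕ} → (∀ j → ℤ.+ (u j) ≡[mod m ] ℤ.+ (v j)) →
                    powerSum s c t u ≡[mod m ] powerSum s c t v
powerSum-cong-mod s c t u≡v =
  sumFin-cong-mod s (λ j → *-cong-mod (≡-mod-refl (c j)) (^-cong-mod (t j) (u≡v j)))

module _ {m : ℕ} .{{_ : NonZero m}} where

  residue : ℕ → Fin m
  residue x = fromℕ< (m%n<n x m)

  residue-≡⇒%-≡ : ∀ {x y} → residue x ≡ residue y → x % m ≡ y % m
  residue-≡⇒%-≡ eq = trans (sym (toℕ-fromℕ< _)) (trans (cong toℕ eq) (toℕ-fromℕ< _))

  window-determines-residue : ∀ (a : ℕ → ℕ) {s} c t {n n′} →
    ℤ.+ (a n) ≡ powerSum s c t (window s a n) → ℤ.+ (a n′) ≡ powerSum s c t (window s a n′) →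
    window s (residue ∘ a) n ≗ window s (residue ∘ a) n′ → residue (a n) ≡ residue (a n′)
  window-determines-residue a {s} c t aₙ≡ aₙ′≡ same = fromℕ<-cong _ _
    (≡-mod⇒%-≡ (subst₂ _≡[mod m ]_ (sym aₙ≡) (sym aₙ′≡)
      (powerSum-cong-mod s c t (λ j → %-≡⇒≡-mod (residue-≡⇒%-≡ (same j)))))) _ _

  recurrence⇒residues-eventuallyPeriodic : ∀ {a} → EventualPowerRecurrence a →
                                           EventuallyPeriodic (λ n → a n % m)
  recurrence⇒residues-eventuallyPeriodic {a} (s , c , t , N , rec) =
    proj₁ periodic , EventualPeriod-∘ toℕ {0} (λ n _ → sym (toℕ-fromℕ< _)) (proj₂ periodic)
    where
    periodic : EventuallyPeriodic (residue ∘ a)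
    periodic = window-determined⇒eventuallyPeriodic (residue ∘ a) N
      (λ N≤n N≤n′ → window-determines-residue a c t (proj₂ (rec _ N≤n)) (proj₂ (rec _ N≤n′)))

mainTheorem4 : (a : ℕ → ℕ) → (∀ n → 1 ≤ n → 0 < a n) → EventualPowerRecurrence a →
    (k : ℕ) → 1 ≤ k →
    EventuallyPeriodic (λ n → Γ k (a n)) ×
    (∀ T P → IsMinimalEventualPeriod (λ n → Γ k (a n)) T →
       IsMinimalEventualPeriod (λ n → a n mod (2 * k)) P → T ∣ P)
mainTheorem4 a a>0 rec (suc k) _ = eventuallyPeriodic , minimal-period-divides
  where
  Γ-of-residue : ℕ → ℕ
  Γ-of-residue r = Γ (suc k) (r + 2 * suc k)
  Γ-via-residue : ∀ n → 1 ≤ n → Γ (suc k) (a n) ≡ Γ-of-residue (a n % (2 * suc k))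
  Γ-via-residue n 1≤n =
    f[n]≡f[n%p+p] (2 * suc k) (λ b 1≤b → Γ-shift (suc k) b {{_}} {{>-nonZero 1≤b}}) (a n) (a>0 n 1≤n)
  periods-transfer : ∀ {p} → EventualPeriod (λ n → a n % (2 * suc k)) p →
                     EventualPeriod (λ n → Γ (suc k) (a n)) p
  periods-transfer = EventualPeriod-∘ Γ-of-residue Γ-via-residue
  eventuallyPeriodic : EventuallyPeriodic (λ n → Γ (suc k) (a n))
  eventuallyPeriodic =
    let p , period = recurrence⇒residues-eventuallyPeriodic {2 * suc k} rec
    in  p , periods-transfer period
  minimal-period-divides : ∀ T P → IsMinimalEventualPeriod (λ n → Γ (suc k) (a n)) T →
    IsMinimalEventualPeriod (λ n → a n mod (2 * suc k)) P → T ∣ P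
  minimal-period-divides T P minimal (period , _) = minimal-period-∣ minimal (periods-transfer period)
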